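{- Let $\mathbf B$ be an involutive bisemilattice with Płonka sum representation $\langle\{\mathbf A_i\}_{i\in I},I,p_{ij}\rangle$, and let $x\cdot y\coloneqq x\wedge(x\vee y)$. The following are equivalent: (1) $\mathbf B$ is injective; (2) $\mathbf B$ satisfies the quasi-identity $x\cdot y\approx x\ \&\ y\cdot x\approx y\ \&\ x\cdot z\approx y\cdot z\ \Rightarrow\ x\approx y$.
   Context: An involutive bisemilattice is an algebra $\mathbf B=\langle B,\wedge,\vee,',0,1\rangle$ of type $(2,2,1,0,0)$ satisfying $x\vee x\approx x$, $x\vee y\approx y\vee x$, $x\vee(y\vee z)\approx(x\vee y)\vee z$, $(x')'\approx x$, $x\wedge y\approx(x'\vee y')'$, $x\wedge(x'\vee y)\approx x\wedge y$, $0\vee x\approx x$, $1\approx 0'$. Every involutive bisemilattice is (canonically) the Płonka sum of a semilattice direct system of Boolean algebras: a join-semilattice $(I,\vee)$ with least element $i_0$, Boolean algebras $\mathbf A_i$ with pairwise disjoint universes, Boolean homomorphisms $p_{ij}\colon\mathbf A_i\to\mathbf A_j$ ($i\le j$) with $p_{ii}=\mathrm{id}$, $p_{ik}=p_{jk}\circ p_{ij}$; $B=\bigsqcup_iA_i$; for $a\in A_i$, $b\in A_j$, $k=i\vee j$: $a\wedge b=p_{ik}(a)\wedge^{\mathbf A_k}p_{jk}(b)$, $a\vee b=p_{ik}(a)\vee^{\mathbf A_k}p_{jk}(b)$; $a'$ computed in the algebra containing $a$; $0,1$ those of $\mathbf A_{i_0}$. (The components $A_i$ are exactly the classes of elements $a,b$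 with $a\cdot b=a$ and $b\cdot a=b$, and $p_{ij}(x)=x\cdot b$ for any $b\in A_j$.) $\mathbf B$ is called injective if $p_{ij}$ is injective for all $i\le j$ in $I$. -}

module Defs where

open import Level using (Level; _⊔_; suc)
open import Data.Product using (Σ; _,_; proj₁; proj₂)
open import Relation.Binary.PropositionalEquality using (_≡_; refl; sym; trans; cong)
open import Algebra.Core using (Op₁; Op₂)
import Algebra.Lattice.Structures as LS
open import Function.Definitions using (Injective)

-- The universes are disjoint since
-- the Płonka sum is taken as the dependent sum Σ I A.
record PlonkaSystem (ι α : Level) : Set (suc (ι ⊔ α)) where
  infixl 6 _⊔ᵢ_
  field
    I      : Set ι
    _⊔ᵢ_   : Op₂ I
    i₀     : I
    ⊔-idem  : ∀ i → i ⊔ᵢ i ≡ i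
    ⊔-comm  : ∀ i j → i ⊔ᵢ j ≡ j ⊔ᵢ i
    ⊔-assoc : ∀ i j k → (i ⊔ᵢ j) ⊔ᵢ k ≡ i ⊔ᵢ (j ⊔ᵢ k)
    i₀-least : ∀ i → i₀ ⊔ᵢ i ≡ i

  _≤ᵢ_ : I → I → Set ι
  i ≤ᵢ j = i ⊔ᵢ j ≡ j

  field
    A   : I → Set α
    ∨ᴬ  : ∀ i → Op₂ (A i)
    ∧ᴬ  : ∀ i → Op₂ (A i)
    ¬ᴬ  : ∀ i → Op₁ (A i)
    ⊤ᴬ  : ∀ i → A i
    ⊥ᴬ  : ∀ i → A i
    isBooleanAlgebra : ∀ i → LS.IsBooleanAlgebra {A = A i} _≡_ (∨ᴬ i) (∧ᴬ i) (¬ᴬ i) (⊤ᴬ i) (⊥ᴬ i)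

    p : ∀ {i j} → i ≤ᵢ j → A i → A j
    p-∨ : ∀ {i j} (h : i ≤ᵢ j) x y → p h (∨ᴬ i x y) ≡ ∨ᴬ j (p h x) (p h y)
    p-∧ : ∀ {i j} (h : i ≤ᵢ j) x y → p h (∧ᴬ i x y) ≡ ∧ᴬ j (p h x) (p h y)
    p-¬ : ∀ {i j} (h : i ≤ᵢ j) x → p h (¬ᴬ i x) ≡ ¬ᴬ j (p h x)
    p-⊤ : ∀ {i j} (h : i ≤ᵢ j) → p h (⊤ᴬ i) ≡ ⊤ᴬ j
    p-⊥ : ∀ {i j} (h : i ≤ᵢ j) → p h (⊥ᴬ i) ≡ ⊥ᴬ j
    p-id    : ∀ {i} (h : i ≤ᵢ i) x → p h x ≡ x
    p-trans : ∀ {i j k} (h₁ : i ≤ᵢ j) (h₂ : j ≤ᵢ k) (h₃ : i ≤ᵢ k) x →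
              p h₃ x ≡ p h₂ (p h₁ x)

  ≤-⊔ˡ : ∀ i j → i ≤ᵢ (i ⊔ᵢ j)
  ≤-⊔ˡ i j = trans (sym (⊔-assoc i i j)) (cong (_⊔ᵢ j) (⊔-idem i))

  ≤-⊔ʳ : ∀ i j → j ≤ᵢ (i ⊔ᵢ j)
  ≤-⊔ʳ i j = trans (cong (j ⊔ᵢ_) (⊔-comm i j)) (trans (≤-⊔ˡ j i) (⊔-comm j i))

  B : Set (ι ⊔ α)
  B = Σ I A

  infixl 7 _∧_
  infixl 6 _∨_
  _∧_ : B → B → B
  (i , a) ∧ (j , b) = (i ⊔ᵢ j) , ∧ᴬ (i ⊔ᵢ j) (p (≤-⊔ˡ i j) a) (p (≤-⊔ʳ i j) b)

  _∨_ : B → B → B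
  (i , a) ∨ (j , b) = (i ⊔ᵢ j) , ∨ᴬ (i ⊔ᵢ j) (p (≤-⊔ˡ i j) a) (p (≤-⊔ʳ i j) b)

  _′ : B → B
  (i , a) ′ = i , ¬ᴬ i a

  0B : B
  0B = i₀ , ⊥ᴬ i₀

  1B : B
  1B = i₀ , ⊤ᴬ i₀

  infixl 8 _·_
  _·_ : B → B → B
  x · y = x ∧ (x ∨ y)

  IsInjective : Set (ι ⊔ α)
  IsInjective = ∀ {i j} (h : i ≤ᵢ j) → Injective _≡_ _≡_ (p h)

  SatisfiesQI : Set (ι ⊔ α)
  SatisfiesQI = ∀ (x y z : B) → x · y ≡ x → y · x ≡ y → x · z ≡ y · z → x ≡ y

-- The proof rests on one computation: in the Płonka sum, x · y := x ∧ (x ∨ y)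
-- is the image of x in the component of x ∨ y,
--     (i , a) · (j , b)  =  (i ⊔ j , p_{i,i⊔j} a)              (·-image)
-- by Boolean absorption  u ∧ (u ∨ w) = u  in A_{i⊔j}.  Consequently
--   * x · y = x  says exactly that the index of y lies below that of x, so the
--     first two premises of the quasi-identity say that x, y lie in one
--     component A_i;
--   * x · z = y · z  then says  p_{i,i⊔l} a = p_{i,i⊔l} b  for z ∈ A_l.
-- (1 ⇒ 2): injectivity of p_{i,i⊔l} gives a = b.
-- (2 ⇒ 1): if p_{ij} a = p_{ij} b, apply the quasi-identity to (i , a),
-- (i , b) and any z ∈ A_j, e.g. its bottom element.
module Submission where

open import Level using (Level)
open import Function.Bundles using (_⇔_; mk⇔)
open import Data.Product using (_,_; proj₁)
open import Relation.Binary.PropositionalEquality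
import Algebra.Lattice.Structures as LS
open import Defs

module PlonkaSum {ι α : Level} (S : PlonkaSystem ι α) where
  open PlonkaSystem S
  open ≡-Reasoning

  -- p_h depends only on the indices, not on the proof h of i ≤ j
  -- (factor p_h' through p_jj = id).
  p-irrelevant : ∀ {i j} (h h′ : i ≤ᵢ j) x → p h x ≡ p h′ x
  p-irrelevant {j = j} h h′ x = begin
    p h x                    ≡⟨ p-id (⊔-idem j) (p h x) ⟨
    p (⊔-idem j) (p h x)     ≡⟨ p-trans h (⊔-idem j) h′ x ⟨
    p h′ x                   ∎

  reindex : ∀ {i k k′} (a : A i) (h : i ≤ᵢ k) (h′ : i ≤ᵢ k′) →
            k ≡ k′ → _≡_ {A = B} (k , p h a) (k′ , p h′ a)
  reindex a h h′ refl = cong (_ ,_) (p-irrelevant h h′ a)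

  entry-≡ : ∀ {i j a b} → _≡_ {A = B} (i , a) (j , b) → (h : i ≤ᵢ j) → p h a ≡ b
  entry-≡ {a = a} refl h = p-id h a

  fibre-≡ : ∀ {k u v} → _≡_ {A = B} (k , u) (k , v) → u ≡ v
  fibre-≡ {k} {u} e = trans (sym (p-id (⊔-idem k) u)) (entry-≡ e (⊔-idem k))

  ≤-antisym : ∀ {i j} → i ≤ᵢ j → j ≤ᵢ i → i ≡ j
  ≤-antisym {i} {j} i≤j j≤i = begin
    i          ≡⟨ j≤i ⟨
    j ⊔ᵢ i     ≡⟨ ⊔-comm j i ⟩
    i ⊔ᵢ j     ≡⟨ i≤j ⟩
    j          ∎

  ∧-absorbs-∨ : ∀ k (u w : A k) → ∧ᴬ k u (∨ᴬ k u w) ≡ u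
  ∧-absorbs-∨ k = LS.IsBooleanAlgebra.∧-absorbs-∨ (isBooleanAlgebra k)

  ·-image : ∀ {i j} (a : A i) (b : A j) →
            (i , a) · (j , b) ≡ (i ⊔ᵢ j , p (≤-⊔ˡ i j) a)
  ·-image {i} {j} a b = begin
    (k , ∧ᴬ k (p i≤k a) (p m≤k (∨ᴬ m (p i≤m a) (p j≤m b))))
      ≡⟨ cong (λ w → k , ∧ᴬ k (p i≤k a) w) (p-∨ m≤k (p i≤m a) (p j≤m b)) ⟩
    (k , ∧ᴬ k (p i≤k a) (∨ᴬ k (p m≤k (p i≤m a)) (p m≤k (p j≤m b))))
      ≡⟨ cong (λ w → k , ∧ᴬ k (p i≤k a) (∨ᴬ k w (p m≤k (p j≤m b))))
              (p-trans i≤m m≤k i≤k a) ⟨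
    (k , ∧ᴬ k (p i≤k a) (∨ᴬ k (p i≤k a) (p m≤k (p j≤m b))))
      ≡⟨ cong (k ,_) (∧-absorbs-∨ k (p i≤k a) (p m≤k (p j≤m b))) ⟩
    (k , p i≤k a)
      ≡⟨ reindex a i≤k i≤m k≡m ⟩
    (m , p i≤m a)
      ∎
    where
    m = i ⊔ᵢ j
    k = i ⊔ᵢ m
    i≤m = ≤-⊔ˡ i j
    j≤m = ≤-⊔ʳ i j
    i≤k = ≤-⊔ˡ i m
    m≤k = ≤-⊔ʳ i m
    k≡m : k ≡ m
    k≡m = i≤m

  ·-fixed⇒≤ : ∀ {i j} {a : A i} {b : A j} → (i , a) · (j , b) ≡ (i , a) → j ≤ᵢ i
  ·-fixed⇒≤ {i} {j} {a} {b} e =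
    trans (⊔-comm j i) (cong proj₁ (trans (sym (·-image a b)) e))

  ≤⇒·-fixed : ∀ {i j} (a : A i) (b : A j) → j ≤ᵢ i → (i , a) · (j , b) ≡ (i , a)
  ≤⇒·-fixed {i} {j} a b j≤i = begin
    (i , a) · (j , b)          ≡⟨ ·-image a b ⟩
    (i ⊔ᵢ j , p (≤-⊔ˡ i j) a)  ≡⟨ reindex a (≤-⊔ˡ i j) (⊔-idem i) i⊔j≡i ⟩
    (i , p (⊔-idem i) a)       ≡⟨ cong (i ,_) (p-id (⊔-idem i) a) ⟩
    (i , a)                    ∎
    where
    i⊔j≡i : i ⊔ᵢ j ≡ i
    i⊔j≡i = trans (⊔-comm i j) j≤i

  -- (1 ⇒ 2)  The first two premises put x and y into one component A_i;
  -- the third then equates their images under the injective p_{i,i⊔l}.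
  injective⇒quasi-identity : IsInjective → SatisfiesQI
  injective⇒quasi-identity inj (i , a) (j , b) (l , c) x·y≡x y·x≡y x·z≡y·z
    with ≤-antisym (·-fixed⇒≤ y·x≡y) (·-fixed⇒≤ x·y≡x)
  ... | refl = cong (i ,_) (inj (≤-⊔ˡ i l) images-equal)
    where
    images-equal : p (≤-⊔ˡ i l) a ≡ p (≤-⊔ˡ i l) b
    images-equal = fibre-≡ (begin
      (i ⊔ᵢ l , p (≤-⊔ˡ i l) a)  ≡⟨ ·-image a c ⟨
      (i , a) · (l , c)          ≡⟨ x·z≡y·z ⟩
      (i , b) · (l , c)          ≡⟨ ·-image b c ⟩
      (i ⊔ᵢ l , p (≤-⊔ˡ i l) b)  ∎)

  -- (2 ⇒ 1)  If p_{ij} a = p_{ij} b, then (i , a) and (i , b) agree on the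
  -- witness z = ⊥ of A_j, so the quasi-identity identifies them.
  quasi-identity⇒injective : SatisfiesQI → IsInjective
  quasi-identity⇒injective qi {i} {j} i≤j {a} {b} pa≡pb =
    fibre-≡ (qi (i , a) (i , b) z
                (≤⇒·-fixed a b (⊔-idem i))
                (≤⇒·-fixed b a (⊔-idem i))
                (trans (·z a) (trans (cong (j ,_) pa≡pb) (sym (·z b)))))
    where
    z : B
    z = j , ⊥ᴬ j
    ·z : ∀ u → (i , u) · z ≡ (j , p i≤j u)
    ·z u = trans (·-image u (⊥ᴬ j)) (reindex u (≤-⊔ˡ i j) i≤j i≤j)

proposition4p3 : ∀ {ι α : Level} (S : PlonkaSystem ι α) →
    PlonkaSystem.IsInjective S ⇔ PlonkaSystem.SatisfiesQI S
proposition4p3 S =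
  mk⇔ (injective⇒quasi-identity S) (quasi-identity⇒injective S)
  where open PlonkaSum
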